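{- Let $\lambda=(\lambda_1,\dots,\lambda_n)$ be a Ferrers board (positive integers $\lambda_1\le\dots\le\lambda_n$), let $\alpha=(\alpha_1,\dots,\alpha_k)$ be a vector of non-negative integers with $\alpha_1+\dots+\alpha_k=n$, let $m$ be a positive integer with $m\le\lambda_1$, and let $\lambda^+=(m,\lambda_1,\dots,\lambda_n)$. Let $1\le i\le m$ and $\alpha^+=\alpha+\mathbf{e}_i$ (the vector $\alpha$ with its $i$-th entry increased by one, padding $\alpha$ with zeros if necessary). Then \[ R_i(\lambda^+,\alpha^+;t)=\sum_{j=1}^{i}R_j(\lambda,\alpha;t)+t\sum_{j=i+1}^{\lambda_1}R_j(\lambda,\alpha;t). \]
   Context: For a Ferrers board $\nu=(\nu_1,\dots,\nu_N)$ and a non-negative integer vector $\beta=(\beta_1,\dots,\beta_k)$ with total sum $N$, $\mathcal{W}(\nu,\beta)$ is the set of words $w=w_1\cdots w_N$ having exactly $\beta_r$ letters equal to $r$ for each $r$ (content $\beta$) and satisfying $1\le w_r\le\nu_r$ for all $r=1,\dots,N$. An ascent of $w$ is an index $r\in[N-1]$ with $w_r<w_{r+1}$, and $\operatorname{asc}(w)$ is their number. For each $j$, $R_j(\nu,\beta;t)=\sum_{w\in\mathcal{W}(\nu,\beta),\ w_1=j}t^{\operatorname{asc}(w)}$. -}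

module Defs where

open import Data.Nat using (ℕ; zero; suc; _+_; _∸_; _≤_; _<ᵇ_; _≟_)
open import Data.Bool using (if_then_else_)
open import Data.List using (List; []; _∷_; map; concatMap; applyUpTo; filter; length; foldr)
open import Data.List.Properties using (≡-dec)
open import Data.List.Relation.Unary.All using (All)
open import Data.List.Relation.Unary.Linked using (Linked)
open import Relation.Nullary.Decidable using (_×-dec_)

Ferrers : List ℕ → Set
Ferrers ν = All (1 ≤_) ν × Linked _≤_ ν
  where open import Data.Product using (_×_)

-- [lo, lo+1, ..., hi]  (empty if hi < lo)
range : ℕ → ℕ → List ℕ
range lo hi = applyUpTo (λ x → lo + x) (suc hi ∸ lo)

boardWords : List ℕ → List (List ℕ)
boardWords []      = [] ∷ []
boardWords (c ∷ ν) = concatMap (λ x → map (x ∷_) (boardWords ν)) (range 1 c)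

count : ℕ → List ℕ → ℕ
count x w = length (filter (x ≟_) w)

contentOf : ℕ → List ℕ → List ℕ
contentOf k w = map (λ r → count r w) (range 1 k)

W : List ℕ → List ℕ → List (List ℕ)
W ν β = filter (λ w → ≡-dec _≟_ (contentOf (length β) w) β) (boardWords ν)

asc : List ℕ → ℕ
asc (x ∷ y ∷ w) = (if x <ᵇ y then 1 else 0) + asc (y ∷ w)
asc _           = 0

-- first letter (0 for the empty word, never a valid letter)
first : List ℕ → ℕ
first []      = 0
first (x ∷ _) = x

-- Polynomials in t with ℕ coefficients, as coefficient functions
Poly : Set
Poly = ℕ → ℕ

_⊕_ : Poly → Poly → Poly
(f ⊕ g) a = f a + g a

zeroP : Poly
zeroP _ = 0

tTimes : Poly → Poly
tTimes f zero    = 0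
tTimes f (suc a) = f a

ΣP : List ℕ → (ℕ → Poly) → Poly
ΣP js F = foldr (λ j acc → F j ⊕ acc) zeroP js

R : List ℕ → List ℕ → ℕ → Poly
R ν β j a = length (filter (λ w → (first w ≟ j) ×-dec (asc w ≟ a)) (W ν β))

-- β + e_i (1-indexed), padding with zeros if necessary
addAt : ℕ → List ℕ → List ℕ
addAt zero          β        = β
addAt (suc zero)    []       = 1 ∷ []
addAt (suc zero)    (x ∷ β)  = suc x ∷ β
addAt (suc (suc i)) []       = 0 ∷ addAt (suc i) []
addAt (suc (suc i)) (x ∷ β)  = x ∷ addAt (suc i) β

-- A word of W(m λ, α + e_i) with first letter i is i·w for a word w ∈ W(λ, α): since the
-- entries of α sum to the length of w, w uses no letter beyond the length of α, so
-- prepending i changes the content exactly by e_i. Prepending i to a word whose first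
-- letter is j creates a new ascent iff i < j, so sorting the words w by their first
-- letter j ∈ [1, λ₁] splits the count into the two sums of the formula.
module Submission where

open import Defs
open import Data.Bool using (true; false; if_then_else_)
open import Data.Empty using (⊥)
open import Data.List using (List; []; _∷_; [_]; _++_; _∷ʳ_; length; map; filter; applyUpTo; concatMap)
open import Data.List.Properties
  using (length-++; length-map; filter-++; filter-accept; filter-reject; filter-none; map-applyUpTo; applyUpTo-∷ʳ; ≡-dec)
open import Data.List.Relation.Unary.All as All using (All; []; _∷_)
open import Data.List.Relation.Unary.All.Properties using (map⁺; concat⁺; applyUpTo⁺₁; filter⁺)
open import Data.Nat using (ℕ; zero; suc; _+_; _∸_; _≤_; _<_; _≤′_; ≤′-reflexive; ≤′-step; _≟_; _<?_; _≤?_; _<ᵇ_; z≤n; s≤s; s≤s⁻¹; z<s; s<s)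
open import Data.Nat.ListAction using (sum)
open import Data.Nat.ListAction.Properties using (sum-++)
open import Data.Nat.Properties
open import Algebra.Properties.CommutativeSemigroup +-commutativeSemigroup using (interchange)
open import Data.Product using (_×_; _,_; proj₂)
open import Function using (_∘_; _⇔_; mk⇔; Equivalence)
open import Relation.Nullary using (yes; no; does; contradiction)
open import Relation.Nullary.Reflects using (ofʸ; ofⁿ)
open import Relation.Nullary.Decidable using (_×-dec_)
open import Relation.Unary using (Decidable)
open import Relation.Binary.PropositionalEquality using (_≡_; _≢_; _≗_; refl; sym; trans; cong; cong₂; subst; module ≡-Reasoning)
open ≡-Reasoning

private variable
  A B : Set

length-filter-++ : {P : A → Set} (P? : Decidable P) (xs ys : List A) →
  length (filter P? (xs ++ ys)) ≡ length (filter P? xs) + length (filter P? ys)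
length-filter-++ P? xs ys = trans (cong length (filter-++ P? xs ys)) (length-++ (filter P? xs))

length-filter-[_] : {P : A → Set} (P? : Decidable P) (x : A) →
  length (filter P? [ x ]) ≡ (if does (P? x) then 1 else 0)
length-filter-[_] P? x with does (P? x)
... | true  = refl
... | false = refl

filter-cong : {P Q : A → Set} (P? : Decidable P) (Q? : Decidable Q) {xs : List A} →
  All (λ x → P x ⇔ Q x) xs → filter P? xs ≡ filter Q? xs
filter-cong P? Q? [] = refl
filter-cong P? Q? {x ∷ xs} (P⇔Q ∷ P⇔Qs) with P? x | Q? x
... | yes _  | yes _  = cong (x ∷_) (filter-cong P? Q? P⇔Qs)
... | no _   | no _   = filter-cong P? Q? P⇔Qs
... | yes Px | no ¬Qx = contradiction (Equivalence.to P⇔Q Px) ¬Qx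
... | no ¬Px | yes Qx = contradiction (Equivalence.from P⇔Q Qx) ¬Px

length-filter-cong : {P Q : A → Set} (P? : Decidable P) (Q? : Decidable Q) {xs : List A} →
  All (λ x → P x ⇔ Q x) xs → length (filter P? xs) ≡ length (filter Q? xs)
length-filter-cong P? Q? P⇔Qs = cong length (filter-cong P? Q? P⇔Qs)

length-filter²-concatMap : {P Q : B → Set} (P? : Decidable P) (Q? : Decidable Q)
  (f : A → List B) (xs : List A) →
  length (filter P? (filter Q? (concatMap f xs))) ≡ sum (map (λ x → length (filter P? (filter Q? (f x)))) xs)
length-filter²-concatMap P? Q? f [] = refl
length-filter²-concatMap P? Q? f (x ∷ xs) = begin
  length (filter P? (filter Q? (f x ++ concatMap f xs)))
    ≡⟨ cong (λ ys → length (filter P? ys)) (filter-++ Q? (f x) (concatMap f xs)) ⟩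
  length (filter P? (filter Q? (f x) ++ filter Q? (concatMap f xs)))
    ≡⟨ length-filter-++ P? (filter Q? (f x)) (filter Q? (concatMap f xs)) ⟩
  length (filter P? (filter Q? (f x))) + length (filter P? (filter Q? (concatMap f xs)))
    ≡⟨ cong (length (filter P? (filter Q? (f x))) +_) (length-filter²-concatMap P? Q? f xs) ⟩
  sum (map (λ x → length (filter P? (filter Q? (f x)))) (x ∷ xs)) ∎

filter-map : {P : B → Set} (P? : Decidable P) (f : A → B) (xs : List A) →
  filter P? (map f xs) ≡ map f (filter (P? ∘ f) xs)
filter-map P? f [] = refl
filter-map P? f (x ∷ xs) with P? (f x)
... | yes _ = cong (f x ∷_) (filter-map P? f xs)
... | no _  = filter-map P? f xs

length-filter²-map : {P Q : B → Set} (P? : Decidable P) (Q? : Decidable Q)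
  (f : A → B) (xs : List A) →
  length (filter P? (filter Q? (map f xs))) ≡ length (filter (P? ∘ f) (filter (Q? ∘ f) xs))
length-filter²-map P? Q? f xs = begin
  length (filter P? (filter Q? (map f xs)))
    ≡⟨ cong (λ ys → length (filter P? ys)) (filter-map Q? f xs) ⟩
  length (filter P? (map f (filter (Q? ∘ f) xs)))
    ≡⟨ cong length (filter-map P? f (filter (Q? ∘ f) xs)) ⟩
  length (map f (filter (P? ∘ f) (filter (Q? ∘ f) xs)))
    ≡⟨ length-map f (filter (P? ∘ f) (filter (Q? ∘ f) xs)) ⟩
  length (filter (P? ∘ f) (filter (Q? ∘ f) xs)) ∎

sum-applyUpTo-zero : (g : ℕ → ℕ) (n : ℕ) → (∀ {x} → x < n → g x ≡ 0) → sum (applyUpTo g n) ≡ 0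
sum-applyUpTo-zero g zero    g≡0 = refl
sum-applyUpTo-zero g (suc n) g≡0 = cong₂ _+_ (g≡0 z<s) (sum-applyUpTo-zero (g ∘ suc) n (g≡0 ∘ s<s))

sum-applyUpTo-pick : (g : ℕ → ℕ) {n y : ℕ} → y < n → (∀ {x} → x ≢ y → g x ≡ 0) →
  sum (applyUpTo g n) ≡ g y
sum-applyUpTo-pick g {suc n} {zero} _ g≡0 =
  trans (cong (g 0 +_) (sum-applyUpTo-zero (g ∘ suc) n (λ _ → g≡0 1+n≢0))) (+-identityʳ (g 0))
sum-applyUpTo-pick g {suc n} {suc y} (s<s y<n) g≡0 =
  cong₂ _+_ (g≡0 0≢1+n) (sum-applyUpTo-pick (g ∘ suc) y<n (λ x≢y → g≡0 (x≢y ∘ suc-injective)))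

sum-applyUpTo-suc : (g : ℕ → ℕ) (n : ℕ) → sum (applyUpTo g (suc n)) ≡ sum (applyUpTo g n) + g n
sum-applyUpTo-suc g n = begin
  sum (applyUpTo g (suc n))        ≡⟨ cong sum (applyUpTo-∷ʳ g n) ⟨
  sum (applyUpTo g n ∷ʳ g n)       ≡⟨ sum-++ (applyUpTo g n) [ g n ] ⟩
  sum (applyUpTo g n) + (g n + 0)  ≡⟨ cong (sum (applyUpTo g n) +_) (+-identityʳ (g n)) ⟩
  sum (applyUpTo g n) + g n        ∎

range-index-bound : ∀ {lo hi x} → x < suc hi ∸ lo → lo + x ≤ hi
range-index-bound {lo} {hi} {x} x<k = subst (_≤ hi) (+-comm x lo) (s≤s⁻¹ (m≤o∸n⇒m+n≤o (suc x) lo≤1+hi x<k))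
  where
  lo≤1+hi : lo ≤ suc hi
  lo≤1+hi = <⇒≤ (m∸n≢0⇒n<m (m<n⇒n≢0 x<k))

range-bounds : (lo hi : ℕ) → All (λ x → lo ≤ x × x ≤ hi) (range lo hi)
range-bounds lo hi = applyUpTo⁺₁ (lo +_) (suc hi ∸ lo) (λ x<k → m≤m+n lo _ , range-index-bound x<k)

sum-range-zero : (f : ℕ → ℕ) (lo hi : ℕ) → (∀ {j} → lo ≤ j → j ≤ hi → f j ≡ 0) →
  sum (map f (range lo hi)) ≡ 0
sum-range-zero f lo hi f≡0 = trans (cong sum (map-applyUpTo (lo +_) f (suc hi ∸ lo)))
  (sum-applyUpTo-zero (f ∘ (lo +_)) _ (λ x<k → f≡0 (m≤m+n lo _) (range-index-bound x<k)))

sum-range-pick : (f : ℕ → ℕ) {lo hi y : ℕ} → lo ≤ y → y ≤ hi → (∀ {j} → j ≢ y → f j ≡ 0) →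
  sum (map f (range lo hi)) ≡ f y
sum-range-pick f {lo} {hi} {y} lo≤y y≤hi f≡0 = begin
  sum (map f (range lo hi))
    ≡⟨ cong sum (map-applyUpTo (lo +_) f (suc hi ∸ lo)) ⟩
  sum (applyUpTo (f ∘ (lo +_)) (suc hi ∸ lo))
    ≡⟨ sum-applyUpTo-pick (f ∘ (lo +_)) (∸-monoˡ-< (s≤s y≤hi) lo≤y) vanishes ⟩
  f (lo + (y ∸ lo))
    ≡⟨ cong f (m+[n∸m]≡n lo≤y) ⟩
  f y ∎
  where
  vanishes : ∀ {x} → x ≢ y ∸ lo → f (lo + x) ≡ 0
  vanishes x≢ = f≡0 (λ lo+x≡y → x≢ (trans (sym (m+n∸m≡n lo _)) (cong (_∸ lo) lo+x≡y)))

ΣP-sum : (js : List ℕ) (F : ℕ → Poly) (a : ℕ) → ΣP js F a ≡ sum (map (λ j → F j a) js)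
ΣP-sum []       F a = refl
ΣP-sum (j ∷ js) F a = cong (F j a +_) (ΣP-sum js F a)

ΣP-cong : (js : List ℕ) {F G : ℕ → Poly} → (∀ j → F j ≗ G j) → ΣP js F ≗ ΣP js G
ΣP-cong []       F≗G a = refl
ΣP-cong (j ∷ js) F≗G a = cong₂ _+_ (F≗G j a) (ΣP-cong js F≗G a)

ΣP-⊕ : (js : List ℕ) (F G : ℕ → Poly) → ΣP js (λ j → F j ⊕ G j) ≗ ΣP js F ⊕ ΣP js G
ΣP-⊕ []       F G a = refl
ΣP-⊕ (j ∷ js) F G a = trans (cong ((F j ⊕ G j) a +_) (ΣP-⊕ js F G a))
  (interchange (F j a) (G j a) (ΣP js F a) (ΣP js G a))

ΣP-range-zero : (F : ℕ → Poly) (lo hi : ℕ) → (∀ {j} → lo ≤ j → j ≤ hi → F j ≗ zeroP) →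
  ΣP (range lo hi) F ≗ zeroP
ΣP-range-zero F lo hi F≗0 a =
  trans (ΣP-sum (range lo hi) F a) (sum-range-zero (λ j → F j a) lo hi (λ lo≤j j≤hi → F≗0 lo≤j j≤hi a))

ΣP-range-pick : (F : ℕ → Poly) {lo hi y : ℕ} → lo ≤ y → y ≤ hi → (∀ {j} → j ≢ y → F j ≗ zeroP) →
  ΣP (range lo hi) F ≗ F y
ΣP-range-pick F {lo} {hi} lo≤y y≤hi F≗0 a =
  trans (ΣP-sum (range lo hi) F a) (sum-range-pick (λ j → F j a) lo≤y y≤hi (λ j≢y → F≗0 j≢y a))

tTimes-cong : {f g : Poly} → f ≗ g → tTimes f ≗ tTimes g
tTimes-cong f≗g zero    = refl
tTimes-cong f≗g (suc a) = f≗g a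

tTimes-⊕ : (f g : Poly) → tTimes (f ⊕ g) ≗ tTimes f ⊕ tTimes g
tTimes-⊕ f g zero    = refl
tTimes-⊕ f g (suc a) = refl

tTimes-zeroP : tTimes zeroP ≗ zeroP
tTimes-zeroP zero    = refl
tTimes-zeroP (suc a) = refl

monomial : ℕ → Poly
monomial e a = if does (e ≟ a) then 1 else 0

tTimes-monomial : (e : ℕ) → tTimes (monomial e) ≗ monomial (suc e)
tTimes-monomial e zero    = refl
tTimes-monomial e (suc a) = refl

prependPoly : ℕ → ℕ → (ℕ → Poly) → Poly
prependPoly i c F = ΣP (range 1 i) F ⊕ tTimes (ΣP (range (suc i) c) F)

prependPoly-cong : (i c : ℕ) {F G : ℕ → Poly} → (∀ j → F j ≗ G j) → prependPoly i c F ≗ prependPoly i c G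
prependPoly-cong i c F≗G a = cong₂ _+_ (ΣP-cong (range 1 i) F≗G a) (tTimes-cong (ΣP-cong (range (suc i) c) F≗G) a)

prependPoly-⊕ : (i c : ℕ) (F G : ℕ → Poly) →
  prependPoly i c (λ j → F j ⊕ G j) ≗ prependPoly i c F ⊕ prependPoly i c G
prependPoly-⊕ i c F G a = trans
  (cong₂ _+_ (ΣP-⊕ (range 1 i) F G a)
             (trans (tTimes-cong (ΣP-⊕ (range (suc i) c) F G) a) (tTimes-⊕ (ΣP (range (suc i) c) F) (ΣP (range (suc i) c) G) a)))
  (interchange (ΣP (range 1 i) F a) (ΣP (range 1 i) G a)
               (tTimes (ΣP (range (suc i) c) F) a) (tTimes (ΣP (range (suc i) c) G) a))

prependPoly-zeroP : (i c : ℕ) → prependPoly i c (λ _ → zeroP) ≗ zeroP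
prependPoly-zeroP i c a = cong₂ _+_ (ΣP-range-zero _ 1 i (λ _ _ _ → refl) a)
  (trans (tTimes-cong (ΣP-range-zero _ (suc i) c (λ _ _ _ → refl)) a) (tTimes-zeroP a))

prependPoly-low : (i c : ℕ) (F : ℕ → Poly) {y : ℕ} → 1 ≤ y → y ≤ i → (∀ {j} → j ≢ y → F j ≗ zeroP) →
  prependPoly i c F ≗ F y
prependPoly-low i c F {y} 1≤y y≤i F≗0 a = trans
  (cong₂ _+_ (ΣP-range-pick F 1≤y y≤i F≗0 a)
             (trans (tTimes-cong (ΣP-range-zero F (suc i) c (λ i<j _ → F≗0 (λ { refl → <⇒≱ i<j y≤i }))) a)
                    (tTimes-zeroP a)))
  (+-identityʳ (F y a))

prependPoly-high : (i c : ℕ) (F : ℕ → Poly) {y : ℕ} → i < y → y ≤ c → (∀ {j} → j ≢ y → F j ≗ zeroP) →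
  prependPoly i c F ≗ tTimes (F y)
prependPoly-high i c F i<y y≤c F≗0 a =
  cong₂ _+_ (ΣP-range-zero F 1 i (λ _ j≤i → F≗0 (λ { refl → <⇒≱ i<y j≤i })) a)
            (tTimes-cong (ΣP-range-pick F i<y y≤c F≗0) a)

asc-∷-≤ : ∀ {i y} (w : List ℕ) → y ≤ i → asc (i ∷ y ∷ w) ≡ asc (y ∷ w)
asc-∷-≤ {i} {y} w y≤i with i <ᵇ y | <ᵇ-reflects-< i y
... | false | _      = refl
... | true  | ofʸ i<y = contradiction y≤i (<⇒≱ i<y)

asc-∷-> : ∀ {i y} (w : List ℕ) → i < y → asc (i ∷ y ∷ w) ≡ suc (asc (y ∷ w))
asc-∷-> {i} {y} w i<y with i <ᵇ y | <ᵇ-reflects-< i y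
... | true  | _       = refl
... | false | ofⁿ i≮y = contradiction i<y i≮y

ascPoly : List (List ℕ) → ℕ → Poly
ascPoly L j a = length (filter (λ w → (first w ≟ j) ×-dec (asc w ≟ a)) L)

ascPolyAfter : ℕ → List (List ℕ) → Poly
ascPolyAfter i L a = length (filter (λ w → asc (i ∷ w) ≟ a) L)

ascPoly-∷ : (w : List ℕ) (L : List (List ℕ)) (j : ℕ) → ascPoly (w ∷ L) j ≗ ascPoly [ w ] j ⊕ ascPoly L j
ascPoly-∷ w L j a = length-filter-++ _ [ w ] L

ascPoly-[]-first : (w : List ℕ) → ascPoly [ w ] (first w) ≗ monomial (asc w)
ascPoly-[]-first w a = trans (length-filter-cong (λ v → (first v ≟ first w) ×-dec (asc v ≟ a)) (λ v → asc v ≟ a) {[ w ]} (mk⇔ proj₂ (refl ,_) ∷ []))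
                             (length-filter-[ (λ v → asc v ≟ a) ] w)

ascPoly-[]-≢ : ∀ {j y} (w : List ℕ) → j ≢ y → ascPoly [ y ∷ w ] j ≗ zeroP
ascPoly-[]-≢ {j} {y} w j≢y a = cong length (filter-reject (λ v → (first v ≟ j) ×-dec (asc v ≟ a)) {y ∷ w} {[]} (λ (y≡j , _) → j≢y (sym y≡j)))

ascPolyAfter-∷ : (i : ℕ) (w : List ℕ) (L : List (List ℕ)) →
  ascPolyAfter i (w ∷ L) ≗ ascPolyAfter i [ w ] ⊕ ascPolyAfter i L
ascPolyAfter-∷ i w L a = length-filter-++ _ [ w ] L

ascPolyAfter-[] : (i : ℕ) (w : List ℕ) → ascPolyAfter i [ w ] ≗ monomial (asc (i ∷ w))
ascPolyAfter-[] i w a = length-filter-[ (λ v → asc (i ∷ v) ≟ a) ] w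

ascPolyAfter-single : (i c : ℕ) {y : ℕ} (w : List ℕ) → 1 ≤ y → y ≤ c →
  ascPolyAfter i [ y ∷ w ] ≗ prependPoly i c (ascPoly [ y ∷ w ])
ascPolyAfter-single i c {y} w 1≤y y≤c a with y ≤? i
... | yes y≤i = begin
  ascPolyAfter i [ y ∷ w ] a                ≡⟨ ascPolyAfter-[] i (y ∷ w) a ⟩
  monomial (asc (i ∷ y ∷ w)) a              ≡⟨ cong (λ e → monomial e a) (asc-∷-≤ w y≤i) ⟩
  monomial (asc (y ∷ w)) a                  ≡⟨ ascPoly-[]-first (y ∷ w) a ⟨
  ascPoly [ y ∷ w ] y a                     ≡⟨ prependPoly-low i c _ 1≤y y≤i (ascPoly-[]-≢ w) a ⟨
  prependPoly i c (ascPoly [ y ∷ w ]) a     ∎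
... | no y≰i = begin
  ascPolyAfter i [ y ∷ w ] a                ≡⟨ ascPolyAfter-[] i (y ∷ w) a ⟩
  monomial (asc (i ∷ y ∷ w)) a              ≡⟨ cong (λ e → monomial e a) (asc-∷-> w i<y) ⟩
  monomial (suc (asc (y ∷ w))) a            ≡⟨ tTimes-monomial (asc (y ∷ w)) a ⟨
  tTimes (monomial (asc (y ∷ w))) a         ≡⟨ tTimes-cong (ascPoly-[]-first (y ∷ w)) a ⟨
  tTimes (ascPoly [ y ∷ w ] y) a            ≡⟨ prependPoly-high i c _ i<y y≤c (ascPoly-[]-≢ w) a ⟨
  prependPoly i c (ascPoly [ y ∷ w ]) a     ∎
  where
  i<y : i < y
  i<y = ≰⇒> y≰i

FirstLetterIn : ℕ → List ℕ → Set
FirstLetterIn c []      = ⊥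
FirstLetterIn c (y ∷ _) = 1 ≤ y × y ≤ c

ascPolyAfter-split : (i c : ℕ) {L : List (List ℕ)} → All (FirstLetterIn c) L →
  ascPolyAfter i L ≗ prependPoly i c (ascPoly L)
ascPolyAfter-split i c [] a = sym (prependPoly-zeroP i c a)
ascPolyAfter-split i c {[] ∷ _} (() ∷ _)
ascPolyAfter-split i c {(y ∷ w) ∷ L} ((1≤y , y≤c) ∷ firsts) a = begin
  ascPolyAfter i ((y ∷ w) ∷ L) a
    ≡⟨ ascPolyAfter-∷ i (y ∷ w) L a ⟩
  ascPolyAfter i [ y ∷ w ] a + ascPolyAfter i L a
    ≡⟨ cong₂ _+_ (ascPolyAfter-single i c w 1≤y y≤c a) (ascPolyAfter-split i c firsts a) ⟩
  prependPoly i c (ascPoly [ y ∷ w ]) a + prependPoly i c (ascPoly L) a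
    ≡⟨ prependPoly-⊕ i c (ascPoly [ y ∷ w ]) (ascPoly L) a ⟨
  prependPoly i c (λ j → ascPoly [ y ∷ w ] j ⊕ ascPoly L j) a
    ≡⟨ prependPoly-cong i c (ascPoly-∷ (y ∷ w) L) a ⟨
  prependPoly i c (ascPoly ((y ∷ w) ∷ L)) a ∎

count-∷-≡ : (x : ℕ) (w : List ℕ) → count x (x ∷ w) ≡ suc (count x w)
count-∷-≡ x w = cong length (filter-accept (x ≟_) {x} {w} refl)

count-∷-≢ : ∀ {x y} (w : List ℕ) → x ≢ y → count x (y ∷ w) ≡ count x w
count-∷-≢ {x} {y} w x≢y = cong length (filter-reject (x ≟_) {y} {w} x≢y)

lettersUpTo : ℕ → List ℕ → ℕ
lettersUpTo zero    w = 0
lettersUpTo (suc n) w = count (suc n) w + lettersUpTo n w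

lettersUpTo-∷-above : ∀ {n x} (w : List ℕ) → n < x → lettersUpTo n (x ∷ w) ≡ lettersUpTo n w
lettersUpTo-∷-above {zero}  w n<x = refl
lettersUpTo-∷-above {suc n} w n<x = cong₂ _+_ (count-∷-≢ w (<⇒≢ n<x)) (lettersUpTo-∷-above w (<⇒≤ n<x))

lettersUpTo-∷ : (n x : ℕ) (w : List ℕ) → lettersUpTo n (x ∷ w) ≤ suc (lettersUpTo n w)
lettersUpTo-∷ zero    x w = z≤n
lettersUpTo-∷ (suc n) x w with suc n ≟ x
... | yes refl = ≤-reflexive (cong₂ _+_ (count-∷-≡ (suc n) w) (lettersUpTo-∷-above {n} w ≤-refl))
... | no  n≢x  = ≤-trans (≤-reflexive (cong (_+ lettersUpTo n (x ∷ w)) (count-∷-≢ w n≢x)))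
  (≤-trans (+-monoʳ-≤ (count (suc n) w) (lettersUpTo-∷ n x w))
           (≤-reflexive (+-suc (count (suc n) w) (lettersUpTo n w))))

lettersUpTo-≤-length : (n : ℕ) (w : List ℕ) → lettersUpTo n w ≤ length w
lettersUpTo-≤-length zero    []      = z≤n
lettersUpTo-≤-length (suc n) []      = lettersUpTo-≤-length n []
lettersUpTo-≤-length n       (x ∷ w) = ≤-trans (lettersUpTo-∷ n x w) (s≤s (lettersUpTo-≤-length n w))

lettersUpTo-mono : ∀ {k n} (w : List ℕ) → k ≤′ n → lettersUpTo k w ≤ lettersUpTo n w
lettersUpTo-mono w (≤′-reflexive refl) = ≤-refl
lettersUpTo-mono w (≤′-step {n} k≤′n) = ≤-trans (lettersUpTo-mono w k≤′n) (m≤n+m (lettersUpTo n w) (count (suc n) w))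

count-beyond : ∀ {k r} (w : List ℕ) → lettersUpTo k w ≡ length w → k ≤ r → count (suc r) w ≡ 0
count-beyond {k} {r} w all k≤r = n≤0⇒n≡0 (+-cancelʳ-≤ (lettersUpTo k w) (count (suc r) w) 0
  (≤-trans (+-monoʳ-≤ (count (suc r) w) (lettersUpTo-mono w (≤⇒≤′ k≤r)))
           (≤-trans (lettersUpTo-≤-length (suc r) w) (≤-reflexive (sym all)))))

contentOf-applyUpTo : (k : ℕ) (w : List ℕ) → contentOf k w ≡ applyUpTo (λ r → count (suc r) w) k
contentOf-applyUpTo k w = map-applyUpTo (1 +_) (λ r → count r w) k

sum-contentOf : (n : ℕ) (w : List ℕ) → sum (contentOf n w) ≡ lettersUpTo n w
sum-contentOf n w = trans (cong sum (contentOf-applyUpTo n w)) (sum-counts n)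
  where
  sum-counts : ∀ n → sum (applyUpTo (λ r → count (suc r) w) n) ≡ lettersUpTo n w
  sum-counts zero    = refl
  sum-counts (suc n) = trans (sum-applyUpTo-suc _ n) (trans (cong (_+ count (suc n) w) (sum-counts n))
                                                            (+-comm (lettersUpTo n w) (count (suc n) w)))

-- entry β r is β_{r+1}, and 0 beyond the end of β.
entry : List ℕ → ℕ → ℕ
entry []      _       = 0
entry (x ∷ β) zero    = x
entry (x ∷ β) (suc r) = entry β r

entry-applyUpTo : (f : ℕ → ℕ) {n r : ℕ} → r < n → entry (applyUpTo f n) r ≡ f r
entry-applyUpTo f {suc n} {zero}  _         = refl
entry-applyUpTo f {suc n} {suc r} (s<s r<n) = entry-applyUpTo (f ∘ suc) r<n

applyUpTo-entry : (β : List ℕ) (f : ℕ → ℕ) → (∀ r → f r ≡ entry β r) → applyUpTo f (length β) ≡ β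
applyUpTo-entry []      f f≡ = refl
applyUpTo-entry (x ∷ β) f f≡ = cong₂ _∷_ (f≡ 0) (applyUpTo-entry β (f ∘ suc) (f≡ ∘ suc))

entry-beyond : (β : List ℕ) {r : ℕ} → length β ≤ r → entry β r ≡ 0
entry-beyond []      _              = refl
entry-beyond (x ∷ β) {suc r} (s≤s β≤r) = entry-beyond β β≤r

entry-addAt-≡ : (i : ℕ) (α : List ℕ) → entry (addAt (suc i) α) i ≡ suc (entry α i)
entry-addAt-≡ zero    []      = refl
entry-addAt-≡ zero    (x ∷ α) = refl
entry-addAt-≡ (suc i) []      = entry-addAt-≡ i []
entry-addAt-≡ (suc i) (x ∷ α) = entry-addAt-≡ i α

entry-addAt-≢ : (i : ℕ) (α : List ℕ) {r : ℕ} → r ≢ i → entry (addAt (suc i) α) r ≡ entry α r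
entry-addAt-≢ zero    []      {zero}  r≢i = contradiction refl r≢i
entry-addAt-≢ zero    []      {suc r} r≢i = refl
entry-addAt-≢ zero    (x ∷ α) {zero}  r≢i = contradiction refl r≢i
entry-addAt-≢ zero    (x ∷ α) {suc r} r≢i = refl
entry-addAt-≢ (suc i) []      {zero}  r≢i = refl
entry-addAt-≢ (suc i) []      {suc r} r≢i = entry-addAt-≢ i [] (r≢i ∘ cong suc)
entry-addAt-≢ (suc i) (x ∷ α) {zero}  r≢i = refl
entry-addAt-≢ (suc i) (x ∷ α) {suc r} r≢i = entry-addAt-≢ i α (r≢i ∘ cong suc)

sum-addAt : (i : ℕ) (α : List ℕ) → sum (addAt (suc i) α) ≡ suc (sum α)
sum-addAt zero    []      = refl
sum-addAt zero    (x ∷ α) = refl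
sum-addAt (suc i) []      = sum-addAt i []
sum-addAt (suc i) (x ∷ α) = trans (cong (x +_) (sum-addAt i α)) (+-suc x (sum α))

-- Unlike contentOf (length β) w ≡ β, this constrains every letter, including those beyond length β.
HasContent : List ℕ → List ℕ → Set
HasContent β w = ∀ r → count (suc r) w ≡ entry β r

contentOf⇔HasContent : (β w : List ℕ) → sum β ≡ length w → (contentOf (length β) w ≡ β) ⇔ HasContent β w
contentOf⇔HasContent β w sβ = mk⇔ has-content (λ h → trans (contentOf-applyUpTo _ w) (applyUpTo-entry β _ h))
  where
  has-content : contentOf (length β) w ≡ β → HasContent β w
  has-content c r with r <? length β
  ... | yes r<k = begin
    count (suc r) w                                               ≡⟨ entry-applyUpTo _ r<k ⟨
    entry (applyUpTo (λ r → count (suc r) w) (length β)) r        ≡⟨ cong (λ γ → entry γ r) (trans (sym (contentOf-applyUpTo _ w)) c) ⟩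
    entry β r                                                     ∎
  ... | no r≮k = trans (count-beyond w full (≮⇒≥ r≮k)) (sym (entry-beyond β (≮⇒≥ r≮k)))
    where
    full : lettersUpTo (length β) w ≡ length w
    full = trans (sym (sum-contentOf (length β) w)) (trans (cong sum c) sβ)

HasContent-∷-addAt : (i : ℕ) (α w : List ℕ) → HasContent (addAt (suc i) α) (suc i ∷ w) ⇔ HasContent α w
HasContent-∷-addAt i α w = mk⇔ remove add
  where
  remove : HasContent (addAt (suc i) α) (suc i ∷ w) → HasContent α w
  remove h r with r ≟ i
  ... | yes refl = suc-injective (trans (sym (count-∷-≡ (suc r) w)) (trans (h r) (entry-addAt-≡ r α)))
  ... | no  r≢i  = trans (sym (count-∷-≢ w (r≢i ∘ suc-injective))) (trans (h r) (entry-addAt-≢ i α r≢i))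
  add : HasContent α w → HasContent (addAt (suc i) α) (suc i ∷ w)
  add h r with r ≟ i
  ... | yes refl = trans (count-∷-≡ (suc r) w) (trans (cong suc (h r)) (sym (entry-addAt-≡ r α)))
  ... | no  r≢i  = trans (count-∷-≢ w (r≢i ∘ suc-injective)) (trans (h r) (sym (entry-addAt-≢ i α r≢i)))

contentOf-∷-addAt : (i : ℕ) (α w : List ℕ) → sum α ≡ length w →
  (contentOf (length (addAt (suc i) α)) (suc i ∷ w) ≡ addAt (suc i) α) ⇔ (contentOf (length α) w ≡ α)
contentOf-∷-addAt i α w sα = mk⇔
  (from α-content ∘ to (HasContent-∷-addAt i α w) ∘ to α⁺-content)
  (from α⁺-content ∘ from (HasContent-∷-addAt i α w) ∘ to α-content)
  where
  open Equivalence
  α-content  = contentOf⇔HasContent α w sα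
  α⁺-content = contentOf⇔HasContent (addAt (suc i) α) (suc i ∷ w) (trans (sum-addAt i α) (cong suc sα))

boardWords-∷⁺ : {P : List ℕ → Set} (c : ℕ) (ν : List ℕ) →
  (∀ {x} → 1 ≤ x → x ≤ c → All (P ∘ (x ∷_)) (boardWords ν)) → All P (boardWords (c ∷ ν))
boardWords-∷⁺ c ν Pν = concat⁺ (map⁺ (All.map (λ (1≤x , x≤c) → map⁺ (Pν 1≤x x≤c)) (range-bounds 1 c)))

boardWords-length : (ν : List ℕ) → All (λ w → length w ≡ length ν) (boardWords ν)
boardWords-length []      = refl ∷ []
boardWords-length (c ∷ ν) = boardWords-∷⁺ c ν (λ _ _ → All.map (cong suc) (boardWords-length ν))

boardWords-first : (c : ℕ) (ν : List ℕ) → All (FirstLetterIn c) (boardWords (c ∷ ν))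
boardWords-first c ν = boardWords-∷⁺ c ν (λ 1≤x x≤c → All.universal (λ _ → 1≤x , x≤c) (boardWords ν))

R-∷-addAt : (c : ℕ) (ν α : List ℕ) (i : ℕ) → sum α ≡ length ν → suc i ≤ c →
  R (c ∷ ν) (addAt (suc i) α) (suc i) ≗ ascPolyAfter (suc i) (W ν α)
R-∷-addAt c ν α i sα 1+i≤c a = begin
  R (c ∷ ν) α⁺ (suc i) a          ≡⟨ length-filter²-concatMap P? Q⁺? (λ x → map (x ∷_) (boardWords ν)) (range 1 c) ⟩
  sum (map N (range 1 c))         ≡⟨ sum-range-pick N (s≤s z≤n) 1+i≤c N-vanishes ⟩
  N (suc i)                       ≡⟨ length-filter²-map P? Q⁺? (suc i ∷_) (boardWords ν) ⟩
  length (filter (P? ∘ (suc i ∷_)) (filter (Q⁺? ∘ (suc i ∷_)) (boardWords ν)))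
    ≡⟨ cong (λ ws → length (filter (P? ∘ (suc i ∷_)) ws)) (filter-cong (Q⁺? ∘ (suc i ∷_)) Qα?
         (All.map (λ |w|≡|ν| → contentOf-∷-addAt i α _ (trans sα (sym |w|≡|ν|))) (boardWords-length ν))) ⟩
  length (filter (P? ∘ (suc i ∷_)) (W ν α))
    ≡⟨ length-filter-cong (P? ∘ (suc i ∷_)) (λ w → asc (suc i ∷ w) ≟ a) {W ν α}
         (All.universal (λ _ → mk⇔ proj₂ (refl ,_)) _) ⟩
  ascPolyAfter (suc i) (W ν α) a  ∎
  where
  α⁺ = addAt (suc i) α
  P? : Decidable (λ w → (first w ≡ suc i) × (asc w ≡ a))
  P? w = (first w ≟ suc i) ×-dec (asc w ≟ a)
  Q⁺? : Decidable (λ w → contentOf (length α⁺) w ≡ α⁺)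
  Q⁺? w = ≡-dec _≟_ (contentOf (length α⁺) w) α⁺
  Qα? : Decidable (λ w → contentOf (length α) w ≡ α)
  Qα? w = ≡-dec _≟_ (contentOf (length α) w) α
  N : ℕ → ℕ
  N x = length (filter P? (filter Q⁺? (map (x ∷_) (boardWords ν))))
  N-vanishes : ∀ {x} → x ≢ suc i → N x ≡ 0
  N-vanishes {x} x≢i = trans (length-filter²-map P? Q⁺? (x ∷_) (boardWords ν))
    (cong length (filter-none (P? ∘ (x ∷_)) {filter (Q⁺? ∘ (x ∷_)) (boardWords ν)}
                              (All.universal (λ _ (x≡i , _) → x≢i x≡i) _)))

lemma3p14 : (λ₁ : ℕ) (λs : List ℕ) (α : List ℕ) (m i : ℕ)
    → Ferrers (λ₁ ∷ λs)
    → sum α ≡ length (λ₁ ∷ λs)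
    → 1 ≤ m → m ≤ λ₁
    → 1 ≤ i → i ≤ m
    → (a : ℕ)
    → R (m ∷ λ₁ ∷ λs) (addAt i α) i a
    ≡ (ΣP (range 1 i) (R (λ₁ ∷ λs) α) ⊕ tTimes (ΣP (range (suc i) λ₁) (R (λ₁ ∷ λs) α))) a
lemma3p14 _  _  _ _ zero    _ _  _ _ () _     _
lemma3p14 λ₁ λs α m (suc i) _ sα _ _ _  1+i≤m a = begin
  R (m ∷ λ₁ ∷ λs) (addAt (suc i) α) (suc i) a     ≡⟨ R-∷-addAt m (λ₁ ∷ λs) α i sα 1+i≤m a ⟩
  ascPolyAfter (suc i) (W (λ₁ ∷ λs) α) a          ≡⟨ ascPolyAfter-split (suc i) λ₁ firstLetters a ⟩
  prependPoly (suc i) λ₁ (R (λ₁ ∷ λs) α) a        ∎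
  where
  firstLetters : All (FirstLetterIn λ₁) (W (λ₁ ∷ λs) α)
  firstLetters = filter⁺ _ (boardWords-first λ₁ λs)
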